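{- If $i \ge 2$ is an integer with $C(i) = 0$, then $\sigma_\infty(4i-2) = \sigma_\infty(4i-1)$.
   Context: $T:\mathbb{Z}^+\to\mathbb{Z}^+$ is defined by $T(x) = x/2$ if $x$ is even and $T(x) = (3x+1)/2$ if $x$ is odd; $T^k$ denotes the $k$-fold iterate, $T^0$ the identity. For $x \in \mathbb{Z}^+$, $\sigma_\infty(x)$ is the least $k \ge 0$ with $T^k(x) = 1$, and $\sigma_\infty(x) = \infty$ if no such $k$ exists. The function $C:\mathbb{Z}^+\to\{0,1\}$ is defined recursively by $C(1) = 0$, $C(n) = 1 - C(n-2)$ if $n > 1$ is odd, and $C(n) = 1 - C(n/2)$ if $n$ is even. -}

module Defs where

open import Data.Nat using (ℕ; zero; suc; _+_; _*_; _<_; _≤_)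
open import Data.Nat.Base using (_/_)
open import Data.Bool using (Bool; true; false; not)
open import Relation.Binary.PropositionalEquality using (_≡_)
open import Relation.Nullary using (¬_)
open import Data.Product using (_×_)

isEven : ℕ → Bool
isEven zero = true
isEven (suc n) = not (isEven n)

-- Collatz (accelerated) map on ℕ (applied only to positive integers)
T : ℕ → ℕ
T x with isEven x
... | true  = x / 2
... | false = (3 * x + 1) / 2

T^ : ℕ → ℕ → ℕ
T^ zero x = x
T^ (suc k) x = T^ k (T x)

σ∞≡ : ℕ → ℕ → Set
σ∞≡ x k = (T^ k x ≡ 1) × (∀ j → j < k → ¬ (T^ j x ≡ 1))

-- equality of σ∞ values in ℕ ∪ {∞}:
-- both are the same finite k, or both are ∞ (no k works for either)
Sameσ∞ : ℕ → ℕ → Set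
Sameσ∞ x y = ∀ k → (σ∞≡ x k → σ∞≡ y k) × (σ∞≡ y k → σ∞≡ x k)

-- C with fuel: C(1)=0, C(n)=1-C(n-2) for odd n>1, C(n)=1-C(n/2) for even n.
-- Bits: false = 0, true = 1.  Fuel ≥ n suffices (each step decreases n).
Cf : ℕ → ℕ → Bool
Cf zero n = false
Cf (suc f) n with isEven n
... | true = not (Cf f (n / 2))
Cf (suc f) (suc zero) | false = false
Cf (suc f) (suc (suc m)) | false = not (Cf f m)
Cf (suc f) zero | false = false

C : ℕ → Bool
C n = Cf n n

{-# OPTIONS --safe #-}
-- Call N tied when σ∞(2N − 2) = σ∞(2N − 1); the claim is that 2i is tied. For M ≥ 2 the
-- trajectories 4M − 2 → 2M − 1 → 3M − 1 and 6M − 2 → 3M − 1 merge while 4M − 1 → 6M − 1, so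
-- if 3M is tied then so is 2M. For N ≡ 3 (mod 4), N ≥ 7, both 2N − 2 and 2N − 1 reach
-- (3N − 1)/4 in three steps, so N is tied. Induction on e then shows that N = 2^e q ≥ 4 is tied
-- whenever 3^e q ≡ 3 (mod 4). Following the recursion of C, C(n) = 0 exactly when n = 2^e q
-- with 3^e q ≡ 1 (mod 4), so N = 2i qualifies.
module Submission where

open import Defs
open import Data.Nat using (ℕ; zero; suc; _+_; _*_; _^_; _∸_; _≤_; s≤s; s≤s⁻¹; z≤n)
open import Data.Nat.Properties
  using ( *-suc; *-identityˡ; *-assoc; *-comm; *-cancelˡ-≡; *-cancelˡ-≤; *-monoʳ-≤; *-monoˡ-≤
        ; ≤-refl; ≤-trans; <-≤-trans; m<m+n; n≤1+n; m+[n∸m]≡n; *-commutativeSemigroup)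
open import Data.Nat.DivMod using (_/_; _%_; m*n/n≡m; m≡m%n+[m/n]*n; %-distribˡ-+; %-distribˡ-*)
open import Data.Nat.Tactic.RingSolver using (solve)
open import Algebra.Properties.CommutativeSemigroup *-commutativeSemigroup using (x∙yz≈y∙xz)
open import Data.List.Base using ([]; _∷_)
open import Data.Bool using (Bool; true; false; not)
open import Data.Product using (∃₂; _×_; _,_; proj₁; proj₂)
open import Data.Empty using (⊥-elim)
open import Function using (_$_)
open import Function.Bundles using (_⇔_; mk⇔; Equivalence)
open import Relation.Nullary using (contradiction)
open import Relation.Binary.PropositionalEquality
open ≡-Reasoning

isEven-double : ∀ k → isEven (2 * k) ≡ true
isEven-double zero = refl
isEven-double (suc k) = trans (cong isEven (*-suc 2 k)) (cong (λ b → not (not b)) (isEven-double k))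

odd≢even : ∀ k m → 1 + 2 * k ≢ 2 * m
odd≢even k m eq = contradiction true≡false λ ()
  where
  true≡false : true ≡ false
  true≡false = trans (sym (isEven-double m)) (trans (cong isEven (sym eq)) (cong not (isEven-double k)))

data Parity : ℕ → Set where
  even : ∀ k → Parity (2 * k)
  odd  : ∀ k → Parity (1 + 2 * k)

parity : ∀ n → Parity n
parity zero = even 0
parity (suc n) with parity n
... | even k = odd k
... | odd k = subst Parity (*-suc 2 k) (even (suc k))

half-double : ∀ k → 2 * k / 2 ≡ k
half-double k = trans (cong (_/ 2) (*-comm 2 k)) (m*n/n≡m k 2)

T-double : ∀ k → T (2 * k) ≡ k
T-double k rewrite isEven-double k = half-double k

T-double+1 : ∀ k → T (1 + 2 * k) ≡ 2 + 3 * k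
T-double+1 k rewrite isEven-double k = trans (cong (_/ 2) 3[1+2k]+1≡[2+3k]*2) (m*n/n≡m (2 + 3 * k) 2)
  where
  3[1+2k]+1≡[2+3k]*2 : 3 * (1 + 2 * k) + 1 ≡ (2 + 3 * k) * 2
  3[1+2k]+1≡[2+3k]*2 = solve (k ∷ [])

T-of-even : ∀ n m → n ≡ 2 * m → T n ≡ m
T-of-even n m refl = T-double m

-- 3n + 1 = 2m forces n to be odd.
T-of-odd : ∀ n m → 2 * m ≡ 1 + 3 * n → T n ≡ m
T-of-odd n m eq with parity n
... | even k = contradiction 1+2[3k]≡2m (odd≢even (3 * k) m)
  where
  1+2[3k]≡2m : 1 + 2 * (3 * k) ≡ 2 * m
  1+2[3k]≡2m = begin 1 + 2 * (3 * k) ≡⟨ solve (k ∷ []) ⟩ 1 + 3 * (2 * k) ≡⟨ eq ⟨ 2 * m ∎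
... | odd k = trans (T-double+1 k) (*-cancelˡ-≡ (2 + 3 * k) m 2 2[2+3k]≡2m)
  where
  2[2+3k]≡2m : 2 * (2 + 3 * k) ≡ 2 * m
  2[2+3k]≡2m = begin 2 * (2 + 3 * k) ≡⟨ solve (k ∷ []) ⟩ 1 + 3 * (1 + 2 * k) ≡⟨ eq ⟨ 2 * m ∎

σ∞≡-suc : ∀ {x k} → x ≢ 1 → σ∞≡ (T x) k → σ∞≡ x (suc k)
σ∞≡-suc x≢1 (reach , least) = reach , λ { zero _ → x≢1 ; (suc j) (s≤s j<k) → least j j<k }

σ∞≡-pred : ∀ {x k} → σ∞≡ x (suc k) → σ∞≡ (T x) k
σ∞≡-pred (reach , least) = reach , λ j j<k → least (suc j) (s≤s j<k)

Sameσ∞-refl : ∀ {x} → Sameσ∞ x x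
Sameσ∞-refl k = (λ s → s) , (λ s → s)

Sameσ∞-trans : ∀ {x y z} → Sameσ∞ x y → Sameσ∞ y z → Sameσ∞ x z
Sameσ∞-trans xy yz k = (λ s → proj₁ (yz k) (proj₁ (xy k) s)) , (λ s → proj₂ (xy k) (proj₂ (yz k) s))

Sameσ∞-step : ∀ {x y x′ y′} → x ≢ 1 → y ≢ 1 → T x ≡ x′ → T y ≡ y′ → Sameσ∞ x′ y′ → Sameσ∞ x y
Sameσ∞-step x≢1 y≢1 refl refl same zero = (λ s → ⊥-elim (x≢1 (proj₁ s))) , (λ s → ⊥-elim (y≢1 (proj₁ s)))
Sameσ∞-step x≢1 y≢1 refl refl same (suc k) =
  (λ s → σ∞≡-suc y≢1 (proj₁ (same k) (σ∞≡-pred s))) , (λ s → σ∞≡-suc x≢1 (proj₂ (same k) (σ∞≡-pred s)))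

same-12+8a : ∀ a → Sameσ∞ (12 + 8 * a) (13 + 8 * a)
same-12+8a a =
  Sameσ∞-step (λ ()) (λ ()) (T-of-even (12 + 8 * a) (6 + 4 * a) (solve (a ∷ [])))
                            (T-of-odd (13 + 8 * a) (20 + 12 * a) (solve (a ∷ []))) $
  Sameσ∞-step (λ ()) (λ ()) (T-of-even (6 + 4 * a) (3 + 2 * a) (solve (a ∷ [])))
                            (T-of-even (20 + 12 * a) (10 + 6 * a) (solve (a ∷ []))) $
  Sameσ∞-step (λ ()) (λ ()) (T-of-odd (3 + 2 * a) (5 + 3 * a) (solve (a ∷ [])))
                            (T-of-even (10 + 6 * a) (5 + 3 * a) (solve (a ∷ []))) $
  Sameσ∞-refl

same-6+4s : ∀ s → Sameσ∞ (10 + 6 * s) (11 + 6 * s) → Sameσ∞ (6 + 4 * s) (7 + 4 * s)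
same-6+4s s same =
  Sameσ∞-step (λ ()) (λ ()) (T-of-even (6 + 4 * s) (3 + 2 * s) (solve (s ∷ [])))
                            (T-of-odd (7 + 4 * s) (11 + 6 * s) (solve (s ∷ []))) $
  Sameσ∞-trans
    (Sameσ∞-step (λ ()) (λ ()) (T-of-odd (3 + 2 * s) (5 + 3 * s) (solve (s ∷ [])))
                               (T-of-even (10 + 6 * s) (5 + 3 * s) (solve (s ∷ [])))
                               Sameσ∞-refl)
    same

Tied : ℕ → Set
Tied N = Sameσ∞ (2 * N ∸ 2) (2 * N ∸ 1)

Tied⇔ : ∀ N m → 2 * N ≡ 2 + m → Tied N ⇔ Sameσ∞ m (1 + m)
Tied⇔ N m eq = mk⇔ (subst Pair eq) (subst Pair (sym eq))
  where
  Pair : ℕ → Set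
  Pair x = Sameσ∞ (x ∸ 2) (x ∸ 1)

tied-7+4a : ∀ a → Tied (7 + 4 * a)
tied-7+4a a = Equivalence.from (Tied⇔ (7 + 4 * a) (12 + 8 * a) (solve (a ∷ []))) (same-12+8a a)

tied-base : ∀ N → 4 ≤ N → N % 4 ≡ 3 → Tied N
tied-base N 4≤N N%4≡3 with N / 4 | m≡m%n+[m/n]*n N 4
... | zero  | N≡N%4 =
  contradiction (subst (4 ≤_) (trans N≡N%4 (cong (_+ 0) N%4≡3)) 4≤N) λ { (s≤s (s≤s (s≤s ()))) }
... | suc a | N≡N%4+[1+a]*4 = subst Tied (sym N≡7+4a) (tied-7+4a a)
  where
  N≡7+4a : N ≡ 7 + 4 * a
  N≡7+4a = trans N≡N%4+[1+a]*4 (trans (cong (_+ suc a * 4) N%4≡3) (cong (7 +_) (*-comm a 4)))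

tied-step : ∀ M → 2 ≤ M → Tied (3 * M) → Tied (2 * M)
tied-step M 2≤M = subst (λ M → Tied (3 * M) → Tied (2 * M)) (m+[n∸m]≡n 2≤M) (step (M ∸ 2))
  where
  step : ∀ s → Tied (3 * (2 + s)) → Tied (2 * (2 + s))
  step s t = Equivalence.from (Tied⇔ (2 * (2 + s)) (6 + 4 * s) (solve (s ∷ [])))
               (same-6+4s s (Equivalence.to (Tied⇔ (3 * (2 + s)) (10 + 6 * s) (solve (s ∷ []))) t))

tied-2^e*q : ∀ e q → 4 ≤ 2 ^ e * q → 3 ^ e * q % 4 ≡ 3 → Tied (2 ^ e * q)
tied-2^e*q zero q 4≤q q%4≡3 = tied-base (1 * q) 4≤q q%4≡3
tied-2^e*q (suc e) q 4≤2^[1+e]q 3^[1+e]q%4≡3 =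
  subst Tied (sym (*-assoc 2 (2 ^ e) q)) (tied-step M 2≤M (subst Tied (x∙yz≈y∙xz (2 ^ e) 3 q) tied-3M))
  where
  M : ℕ
  M = 2 ^ e * q
  4≤2M : 4 ≤ 2 * M
  4≤2M = subst (4 ≤_) (*-assoc 2 (2 ^ e) q) 4≤2^[1+e]q
  2≤M : 2 ≤ M
  2≤M = *-cancelˡ-≤ 2 4≤2M
  tied-3M : Tied (2 ^ e * (3 * q))
  tied-3M = tied-2^e*q e (3 * q)
    (subst (4 ≤_) (sym (x∙yz≈y∙xz (2 ^ e) 3 q)) (≤-trans 4≤2M (*-monoˡ-≤ M {2} {3} (s≤s (s≤s z≤n)))))
    (subst (λ x → x % 4 ≡ 3) (trans (*-assoc 3 (3 ^ e) q) (sym (x∙yz≈y∙xz (3 ^ e) 3 q))) 3^[1+e]q%4≡3)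

residue : Bool → ℕ
residue false = 1
residue true  = 3

-- 3^e q is n with every factor 2 replaced by a 3.
SwapResidue : ℕ → ℕ → Set
SwapResidue r n = ∃₂ λ e q → n ≡ 2 ^ e * q × 3 ^ e * q % 4 ≡ r

tied-of-swapResidue : ∀ {N} → 4 ≤ N → SwapResidue 3 N → Tied N
tied-of-swapResidue 4≤N (e , q , refl , res) = tied-2^e*q e q 4≤N res

3*residue%4 : ∀ b → 3 * residue b % 4 ≡ residue (not b)
3*residue%4 false = refl
3*residue%4 true  = refl

2+residue%4 : ∀ b → (2 + residue b) % 4 ≡ residue (not b)
2+residue%4 false = refl
2+residue%4 true  = refl

residue-3* : ∀ b x → x % 4 ≡ residue b → 3 * x % 4 ≡ residue (not b)
residue-3* b x x%4 = begin
  3 * x % 4           ≡⟨ %-distribˡ-* 3 x 4 ⟩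
  3 * (x % 4) % 4     ≡⟨ cong (λ r → 3 * r % 4) x%4 ⟩
  3 * residue b % 4   ≡⟨ 3*residue%4 b ⟩
  residue (not b)     ∎

residue-2+ : ∀ b x → x % 4 ≡ residue b → (2 + x) % 4 ≡ residue (not b)
residue-2+ b x x%4 = begin
  (2 + x) % 4         ≡⟨ %-distribˡ-+ 2 x 4 ⟩
  (2 + x % 4) % 4     ≡⟨ cong (λ r → (2 + r) % 4) x%4 ⟩
  (2 + residue b) % 4 ≡⟨ 2+residue%4 b ⟩
  residue (not b)     ∎

swapResidue-double : ∀ {b n} → SwapResidue (residue b) n → SwapResidue (residue (not b)) (2 * n)
swapResidue-double {b} (e , q , refl , res) =
  suc e , q , sym (*-assoc 2 (2 ^ e) q) ,
  trans (cong (_% 4) (*-assoc 3 (3 ^ e) q)) (residue-3* b (3 ^ e * q) res)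

swapResidue-of-% : ∀ {r n} → n % 4 ≡ r → SwapResidue r n
swapResidue-of-% {n = n} n%4 = 0 , n , sym (*-identityˡ n) , trans (cong (_% 4) (*-identityˡ n)) n%4

swapResidue-odd : ∀ {r} k → SwapResidue r (1 + 2 * k) → (1 + 2 * k) % 4 ≡ r
swapResidue-odd k (zero , q , eq , res) = trans (cong (_% 4) eq) res
swapResidue-odd k (suc e , q , eq , _) = contradiction (trans eq (*-assoc 2 (2 ^ e) q)) (odd≢even k (2 ^ e * q))

Cf-even : ∀ {f n} → isEven n ≡ true → Cf (suc f) n ≡ not (Cf f (n / 2))
Cf-even n-even rewrite n-even = refl

Cf-2+ : ∀ {f n} → isEven n ≡ false → Cf (suc f) (2 + n) ≡ not (Cf f n)
Cf-2+ n-odd rewrite n-odd = refl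

Cf-double : ∀ f k → Cf (suc f) (2 * k) ≡ not (Cf f k)
Cf-double f k = trans (Cf-even {f} {2 * k} (isEven-double k)) (cong (λ m → not (Cf f m)) (half-double k))

Cf-swapResidue : ∀ f n → 1 ≤ n → n ≤ f → SwapResidue (residue (Cf f n)) n
Cf-swapResidue zero (suc n) _ ()
Cf-swapResidue (suc f) n 1≤n n≤1+f with parity n
... | even zero = contradiction 1≤n λ ()
... | even (suc k) =
  subst (λ b → SwapResidue (residue b) (2 * suc k)) (sym (Cf-double f (suc k)))
    (swapResidue-double (Cf-swapResidue f (suc k) (s≤s z≤n) 1+k≤f))
  where
  1+k≤f : suc k ≤ f
  1+k≤f = s≤s⁻¹ (<-≤-trans (m<m+n (suc k) (s≤s z≤n)) n≤1+f)
... | odd zero = 0 , 1 , refl , refl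
... | odd (suc k) =
  subst (λ n → SwapResidue (residue (Cf (suc f) n)) n) (sym n≡2+m)
    (subst (λ b → SwapResidue (residue b) (2 + m)) (sym (Cf-2+ {f} (cong not (isEven-double k))))
      (swapResidue-of-% (residue-2+ (Cf f m) m (swapResidue-odd k (Cf-swapResidue f m (s≤s z≤n) m≤f)))))
  where
  m : ℕ
  m = 1 + 2 * k
  n≡2+m : 1 + 2 * suc k ≡ 2 + m
  n≡2+m = cong suc (*-suc 2 k)
  m≤f : m ≤ f
  m≤f = ≤-trans (n≤1+n m) (s≤s⁻¹ (subst (_≤ suc f) n≡2+m n≤1+f))

C-swapResidue : ∀ n → 1 ≤ n → SwapResidue (residue (C n)) n
C-swapResidue n 1≤n = Cf-swapResidue n n 1≤n ≤-refl

corollary5p5 : (i : ℕ) → 2 ≤ i → C i ≡ false → Sameσ∞ (4 * i ∸ 2) (4 * i ∸ 1)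
corollary5p5 i 2≤i C≡0 =
  subst (λ x → Sameσ∞ (x ∸ 2) (x ∸ 1)) (sym (*-assoc 2 2 i))
    (tied-of-swapResidue (*-monoʳ-≤ 2 2≤i) (swapResidue-double {false} swap-i))
  where
  swap-i : SwapResidue 1 i
  swap-i = subst (λ b → SwapResidue (residue b) i) C≡0 (C-swapResidue i (≤-trans (s≤s z≤n) 2≤i))
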